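{- Let $q$ be a positive integer and $\varepsilon>0$. Let $\mathcal{F}\subseteq\mathcal{B}_n$ with $\mu(\mathcal{F})\ge q-1+\varepsilon$, and let $\mathcal{T}=\{(\chi,F):\chi\in\mathcal{C},\ F\in\chi\cap\mathcal{F},\ |\chi\cap\mathcal{F}|\ge q\}$. Then $\mathcal{T}$ is a $q$-strong $1$-marked chain family from $\mathcal{F}$ satisfying $|\mathcal{T}|\ge\varepsilon n!$. In particular, if $|\mathcal{F}|\ge(q-1+\varepsilon)\max_{F\in\mathcal{F}}\binom{n}{|F|}$ then $|\mathcal{T}|\ge\varepsilon n!$.
   Context: $\mathcal{B}_n$ is the power set of $[n]$ ordered by inclusion. The Lubell weight is $\mu(\mathcal{F})=\sum_{F\in\mathcal{F}}1/\binom{n}{|F|}$. A full chain is a chain $\emptyset=C_0\subset C_1\subset\dots\subset C_n=[n]$; $\mathcal{C}$ is the set of all full chains. A $1$-marked chain family from $\mathcal{F}$ is a set $\mathcal{T}$ of pairs $(\chi,F)$ with $\chi\in\mathcal{C}$ and $F\in\mathcal{F}\cap\chi$; $|\mathcal{T}|$ is its number of pairs; $\mathcal{T}(\chi)=\{F:(\chi,F)\in\mathcal{T}\}$; $\mathcal{T}$ is $q$-strong if $|\mathcal{T}(\chi)|\ge q$ whenever $\mathcal{T}(\chi)\ne\emptyset$. -}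

module Defs where

open import Data.Bool using (Bool; true; false; if_then_else_)
open import Data.Nat as ℕ using (ℕ; zero; suc; _≤_; _<_; z≤n; s≤s; NonZero; >-nonZero)
open import Data.Nat.Properties as ℕP using (≤-trans; m≤m+n)
open import Data.Nat.Combinatorics using (_C_; nCk≡nC[n∸k]; nCn≡1; nCk+nC[k+1]≡[n+1]C[k+1])
open import Data.Integer using (+_)
open import Data.Rational using (ℚ; _/_; _+_; _*_; 0ℚ)
open import Data.Fin using (Fin; zero; suc; fromℕ; inject₁)
open import Data.Fin.Subset using (Subset; ∣_∣; _⊂_; ⊥; ⊤)
open import Data.Fin.Subset.Properties using (∣p∣≤n)
open import Data.Vec using (Vec; []; _∷_; lookup; toList)
open import Data.Vec.Membership.Propositional as VM using ()
open import Data.List using (List; []; _∷_; _++_; map; filter; length; foldr)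
open import Data.List.Relation.Unary.All using (All)
open import Data.List.Relation.Unary.Unique.Propositional using (Unique)
open import Data.Product using (Σ; _×_; _,_)
open import Relation.Binary.PropositionalEquality using (_≡_; refl; sym; trans; subst)

-- B_n: subsets of [n] = Fin n, as characteristic vectors (Subset n).
-- A family 𝓕 ⊆ B_n is given by its characteristic function.

Family : ℕ → Set
Family n = Subset n → Bool

subsets : (n : ℕ) → List (Subset n)
subsets zero    = [] ∷ []
subsets (suc n) = map (true ∷_) (subsets n) ++ map (false ∷_) (subsets n)

keep : ∀ {A : Set} → (A → Bool) → List A → List A
keep p []       = []
keep p (x ∷ xs) = if p x then x ∷ keep p xs else keep p xs

members : ∀ {n} → Family n → List (Subset n)
members {n} 𝓕 = keep 𝓕 (subsets n)

card : ∀ {n} → Family n → ℕ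
card 𝓕 = length (members 𝓕)

nCk>0 : ∀ n k → k ≤ n → 0 < n C k
nCk>0 n zero _ = subst (0 <_) (sym (trans (nCk≡nC[n∸k] {n = n} (z≤n {n})) (nCn≡1 n))) (s≤s z≤n)
nCk>0 (suc m) (suc j) (s≤s j≤m) =
  subst (0 <_) (nCk+nC[k+1]≡[n+1]C[k+1] m j)
        (≤-trans (nCk>0 m j j≤m) (m≤m+n (m C j) (m C suc j)))

invBinom : ∀ n → Subset n → ℚ
invBinom n S = _/_ (+ 1) (n C ∣ S ∣) {{>-nonZero (nCk>0 n ∣ S ∣ (∣p∣≤n S))}}

lubell : ∀ {n} → Family n → ℚ
lubell {n} 𝓕 = foldr (λ S acc → invBinom n S + acc) 0ℚ (members 𝓕)

-- max_{F ∈ 𝓕} binom(n, |F|)   (0 for the empty family)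
maxBinom : ∀ {n} → Family n → ℕ
maxBinom {n} 𝓕 = foldr (λ S acc → (n C ∣ S ∣) ℕ.⊔ acc) 0 (members 𝓕)

IsFullChain : ∀ {n} → Vec (Subset n) (suc n) → Set
IsFullChain {n} χ =
  (lookup χ zero ≡ ⊥) × (lookup χ (fromℕ n) ≡ ⊤) ×
  ((i : Fin n) → lookup χ (inject₁ i) ⊂ lookup χ (suc i))

Chain : ℕ → Set
Chain n = Vec (Subset n) (suc n)

-- |χ ∩ 𝓕|  (the C_i of a full chain are pairwise distinct)
chainMeet : ∀ {n} → Family n → Chain n → ℕ
chainMeet 𝓕 χ = foldr (λ S acc → (if 𝓕 S then 1 else 0) ℕ.+ acc) 0 (toList χ)

MarkedPair : ℕ → Set
MarkedPair n = Chain n × Subset n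

IsMarkedFamily : ∀ {n} → Family n → (MarkedPair n → Set) → Set
IsMarkedFamily {n} 𝓕 𝓣 =
  ∀ (χ : Chain n) (F : Subset n) → 𝓣 (χ , F) →
    IsFullChain χ × (F VM.∈ χ) × (𝓕 F ≡ true)

AtLeast : ∀ {A : Set} → ℕ → (A → Set) → Set
AtLeast {A} m P = Σ (List A) λ xs → Unique xs × All P xs × m ≤ length xs

AtLeastℚ : ∀ {A : Set} → ℚ → (A → Set) → Set
AtLeastℚ {A} r P = Σ (List A) λ xs → Unique xs × All P xs × Data.Rational._≤_ r (+ length xs / 1)
  where import Data.Rational

IsStrong : ∀ {n} → ℕ → (MarkedPair n → Set) → Set
IsStrong {n} q 𝓣 =
  ∀ (χ : Chain n) (F : Subset n) → 𝓣 (χ , F) → AtLeast q (λ G → 𝓣 (χ , G))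

𝓣[_,_] : ∀ {n} → ℕ → Family n → MarkedPair n → Set
𝓣[ q , 𝓕 ] (χ , F) = IsFullChain χ × (F VM.∈ χ) × (𝓕 F ≡ true) × (q ≤ chainMeet 𝓕 χ)

{-# OPTIONS --safe #-}
module Submission where

-- A full chain of B_n is determined by the order in which it adds the elements of [n], and a
-- k-set lies on k! (n - k)! of the n! full chains. Summing |χ ∩ 𝓕| over all full chains thus
-- gives n! μ(𝓕) ≥ (q - 1 + ε) n!. Each chain with |χ ∩ 𝓕| ≥ q contributes all of χ ∩ 𝓕 to 𝓣
-- and every other chain meets 𝓕 in at most q - 1 sets, so |𝓣| ≥ n! μ(𝓕) - (q - 1) n! ≥ ε n!.
-- For the second claim, every F ∈ 𝓕 has weight at least 1 / max binom(n, |F|), so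
-- |𝓕| ≤ μ(𝓕) max binom(n, |F|) and the first claim applies.

open import Defs

module ChainCounting where

  open import Level using (Level)
  open import Data.Bool using (Bool; true; false; if_then_else_)
  open import Data.Bool.Properties using (T-≡)
  open import Data.Nat using (ℕ; zero; suc; _+_; _*_; _∸_; _≤_; _<_; _!; _<ᵇ_; pred; z≤n; s≤s; s≤s⁻¹; _<?_; _≤?_; _≟_)
  open import Data.Nat.Properties
  open import Data.Nat.ListAction using (sum)
  open import Data.Nat.ListAction.Properties using (sum-++)
  open import Data.Nat.Tactic.RingSolver using (solve-∀)
  open import Data.Fin using (Fin; zero; suc; toℕ; punchIn; punchOut; fromℕ; fromℕ<; inject₁)
  open import Data.Fin.Properties
    using (toℕ<n; toℕ≤pred[n]; toℕ-fromℕ<; toℕ-injective; toℕ-fromℕ; toℕ-inject₁; punchIn-injective; punchIn-punchOut)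
    renaming (_≟_ to _≟ᶠ_)
  open import Data.Fin.Subset using (Subset; ∣_∣; _∈_; _⊂_) renaming (⊥ to ⊥ₛ; ⊤ to ⊤ₛ)
  open import Data.Fin.Subset.Properties using (∣p∣≤n; Empty-unique; ⊆-antisym; ⊆⊤; ⊂-trans; ⊂-irref)
  open import Data.Unit using (⊤; tt)
  open import Data.Vec using (Vec; []; _∷_; lookup; tabulate; toList)
  open import Data.Vec.Properties using (lookup∘tabulate; tabulate-cong; []=⇒lookup; lookup⇒[]=)
  import Data.Vec.Membership.Propositional as VM
  open import Data.Vec.Membership.Propositional.Properties using (∈-toList⁻)
  open import Data.List using (List; []; _∷_; _++_; map; foldr; length; allFin; cartesianProduct; concatMap; filterᵇ)
  open import Data.List.Properties using (map-cong; map-++; map-∘; map-tabulate; length-++; length-map; length-tabulate)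
  open import Data.List.Membership.Propositional using () renaming (_∈_ to _∈ₗ_)
  open import Data.List.Membership.Propositional.Properties using (∈-filter⁻)
  open import Data.List.Relation.Unary.All as All using (All; []; _∷_)
  import Data.List.Relation.Unary.All.Properties as All
  import Data.List.Relation.Unary.AllPairs as AllPairs
  import Data.List.Relation.Unary.AllPairs.Properties as AllPairs
  open import Data.List.Relation.Unary.Linked using (Linked; [-]; _∷_)
  open import Data.List.Relation.Unary.Linked.Properties using (Linked⇒AllPairs)
  open import Data.List.Relation.Unary.Unique.Propositional using (Unique)
  import Data.List.Relation.Unary.Unique.Propositional.Properties as Unique
  open import Data.List.Relation.Binary.Disjoint.Propositional using (Disjoint)
  open import Data.Product using (_×_; _,_; proj₁; proj₂; ∃)
  open import Function using (_∘_; id; Equivalence)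
  open import Relation.Binary using (Rel)
  open import Relation.Binary.PropositionalEquality
  open import Relation.Nullary using (Dec; ¬_; does; yes; no)
  open import Relation.Nullary.Decidable using (T?; dec-true; dec-false)

  private variable
    a b ℓ : Level
    A : Set a
    B : Set b

  ∑ : List A → (A → ℕ) → ℕ
  ∑ xs f = sum (map f xs)

  syntax ∑ xs (λ x → e) = ∑[ x ∈ xs ] e

  ∑-cong : ∀ {f g : A → ℕ} → f ≗ g → ∀ xs → ∑ xs f ≡ ∑ xs g
  ∑-cong f≗g xs = cong sum (map-cong f≗g xs)

  ∑-++ : ∀ (f : A → ℕ) xs ys → ∑ (xs ++ ys) f ≡ ∑ xs f + ∑ ys f
  ∑-++ f xs ys = trans (cong sum (map-++ f xs ys)) (sum-++ (map f xs) (map f ys))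

  ∑-const : ∀ (xs : List A) a → ∑ xs (λ _ → a) ≡ length xs * a
  ∑-const []       a = refl
  ∑-const (x ∷ xs) a = cong (a +_) (∑-const xs a)

  ∑-zero : ∀ (xs : List A) → ∑ xs (λ _ → 0) ≡ 0
  ∑-zero xs = trans (∑-const xs 0) (*-zeroʳ (length xs))

  ∑-+ : ∀ (f g : A → ℕ) xs → ∑[ x ∈ xs ] (f x + g x) ≡ ∑ xs f + ∑ xs g
  ∑-+ f g []       = refl
  ∑-+ f g (x ∷ xs) = trans (cong (f x + g x +_) (∑-+ f g xs)) (+-+-swap (f x) (g x) _ _)
    where
    +-+-swap : ∀ a b c d → a + b + (c + d) ≡ a + c + (b + d)
    +-+-swap = solve-∀

  ∑-*ˡ : ∀ a (f : A → ℕ) xs → a * ∑ xs f ≡ ∑[ x ∈ xs ] (a * f x)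
  ∑-*ˡ a f []       = *-zeroʳ a
  ∑-*ˡ a f (x ∷ xs) = trans (*-distribˡ-+ a (f x) _) (cong (a * f x +_) (∑-*ˡ a f xs))

  ∑-mono-≤ : ∀ {f g : A → ℕ} → (∀ x → f x ≤ g x) → ∀ xs → ∑ xs f ≤ ∑ xs g
  ∑-mono-≤ f≤g []       = z≤n
  ∑-mono-≤ f≤g (x ∷ xs) = +-mono-≤ (f≤g x) (∑-mono-≤ f≤g xs)

  ∑-keep : ∀ (p : A → Bool) (f : A → ℕ) xs → ∑ (keep p xs) f ≡ ∑[ x ∈ xs ] (if p x then f x else 0)
  ∑-keep p f []       = refl
  ∑-keep p f (x ∷ xs) with p x
  ... | true  = cong (f x +_) (∑-keep p f xs)
  ... | false = ∑-keep p f xs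

  ∑-map : ∀ (g : A → B) (f : B → ℕ) xs → ∑ (map g xs) f ≡ ∑ xs (f ∘ g)
  ∑-map g f xs = cong sum (sym (map-∘ xs))

  ∑-comm : ∀ (f : A → B → ℕ) xs ys → ∑[ x ∈ xs ] ∑[ y ∈ ys ] f x y ≡ ∑[ y ∈ ys ] ∑[ x ∈ xs ] f x y
  ∑-comm f []       ys = sym (∑-zero ys)
  ∑-comm f (x ∷ xs) ys = trans (cong (∑ ys (f x) +_) (∑-comm f xs ys)) (sym (∑-+ (f x) _ ys))

  ∑-cartesianProduct : ∀ (f : A × B → ℕ) xs ys →
                       ∑ (cartesianProduct xs ys) f ≡ ∑[ x ∈ xs ] ∑[ y ∈ ys ] f (x , y)
  ∑-cartesianProduct f []       ys = refl
  ∑-cartesianProduct f (x ∷ xs) ys = begin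
    ∑ (map (x ,_) ys ++ cartesianProduct xs ys) f                ≡⟨ ∑-++ f (map (x ,_) ys) _ ⟩
    ∑ (map (x ,_) ys) f + ∑ (cartesianProduct xs ys) f           ≡⟨ cong₂ _+_ (∑-map (x ,_) f ys) (∑-cartesianProduct f xs ys) ⟩
    ∑[ y ∈ ys ] f (x , y) + ∑[ x′ ∈ xs ] ∑[ y ∈ ys ] f (x′ , y)  ∎
    where open ≡-Reasoning

  length-cartesianProduct : ∀ (xs : List A) (ys : List B) →
                            length (cartesianProduct xs ys) ≡ length xs * length ys
  length-cartesianProduct []       ys = refl
  length-cartesianProduct (x ∷ xs) ys = trans (length-++ (map (x ,_) ys))
    (cong₂ _+_ (length-map (x ,_) ys) (length-cartesianProduct xs ys))

  length-concatMap : ∀ (f : A → List B) xs → length (concatMap f xs) ≡ ∑[ x ∈ xs ] length (f x)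
  length-concatMap f []       = refl
  length-concatMap f (x ∷ xs) = trans (length-++ (f x)) (cong (length (f x) +_) (length-concatMap f xs))

  ∑-allFin-suc : ∀ n (f : Fin (suc n) → ℕ) → ∑ (allFin (suc n)) f ≡ f zero + ∑ (allFin n) (f ∘ suc)
  ∑-allFin-suc n f = cong (λ xs → f zero + sum xs) (trans (map-tabulate suc f) (sym (map-tabulate id (f ∘ suc))))

  ∑-allFin-split : ∀ i k X Y → ∑[ j ∈ allFin (i + k) ] (if does (toℕ j <? i) then X else Y) ≡ i * X + k * Y
  ∑-allFin-split zero    k X Y = trans (∑-const (allFin k) Y) (cong (_* Y) (length-tabulate {n = k} id))
  ∑-allFin-split (suc i) k X Y = begin
    ∑[ j ∈ allFin (suc i + k) ] (if does (toℕ j <? suc i) then X else Y)  ≡⟨ ∑-allFin-suc (i + k) _ ⟩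
    X + ∑[ j ∈ allFin (i + k) ] (if does (toℕ j <? i) then X else Y)      ≡⟨ cong (X +_) (∑-allFin-split i k X Y) ⟩
    X + (i * X + k * Y)                                                   ≡⟨ +-assoc X (i * X) (k * Y) ⟨
    suc i * X + k * Y                                                     ∎
    where open ≡-Reasoning

  ∑-allFin-≟ : ∀ n m v → m ≤ n → ∑[ i ∈ allFin (suc n) ] (if does (m ≟ toℕ i) then v else 0) ≡ v
  ∑-allFin-≟ n       zero    v _         = begin
    ∑[ i ∈ allFin (suc n) ] (if does (0 ≟ toℕ i) then v else 0)  ≡⟨ ∑-allFin-suc n _ ⟩
    v + ∑ (allFin n) (λ _ → 0)                                   ≡⟨ cong (v +_) (∑-zero (allFin n)) ⟩
    v + 0                                                        ≡⟨ +-identityʳ v ⟩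
    v                                                            ∎
    where open ≡-Reasoning
  ∑-allFin-≟ (suc n) (suc m) v (s≤s m≤n) =
    trans (∑-allFin-suc (suc n) (λ i → if does (suc m ≟ toℕ i) then v else 0)) (∑-allFin-≟ n m v m≤n)

  ≡-if-does : ∀ {P : Set} (P? : Dec P) {x y z : A} → (P → z ≡ x) → (¬ P → z ≡ y) → z ≡ (if does P? then x else y)
  ≡-if-does (yes p)  z≡x _   = z≡x p
  ≡-if-does (no ¬p)  _   z≡y = z≡y ¬p

  length-filterᵇ : ∀ (p : A → Bool) xs →
                   length (filterᵇ p xs) ≡ foldr (λ x acc → (if p x then 1 else 0) + acc) 0 xs
  length-filterᵇ p []       = refl
  length-filterᵇ p (x ∷ xs) with p x
  ... | true  = cong suc (length-filterᵇ p xs)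
  ... | false = length-filterᵇ p xs

  foldr-+-tabulate : ∀ {m} (g : A → ℕ) (f : Fin m → A) →
                     foldr (λ x acc → g x + acc) 0 (toList (tabulate f)) ≡ ∑ (allFin m) (g ∘ f)
  foldr-+-tabulate {m = zero}  g f = refl
  foldr-+-tabulate {m = suc m} g f =
    trans (cong (g (f zero) +_) (foldr-+-tabulate g (f ∘ suc))) (sym (∑-allFin-suc m (g ∘ f)))

  toList-linked : ∀ {R : Rel A ℓ} {m} (v : Vec A (suc m)) →
                  (∀ i → R (lookup v (inject₁ i)) (lookup v (suc i))) → Linked R (toList v)
  toList-linked (x ∷ [])     _ = [-]
  toList-linked (x ∷ y ∷ v) R-step = R-step zero ∷ toList-linked (y ∷ v) (R-step ∘ suc)

  -- Full chains from permutations

  -- A code (j , c) : Code (suc n) builds a permutation by insertion: element 0 gets rank j and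
  -- the ranks that c gives to the other elements are shifted past j by punchIn. The level sets
  -- {x | rank x < i} then form the full chain that adds the elements in rank order.
  Code : ℕ → Set
  Code zero    = ⊤
  Code (suc n) = Fin (suc n) × Code n

  codes : ∀ n → List (Code n)
  codes zero    = tt ∷ []
  codes (suc n) = cartesianProduct (allFin (suc n)) (codes n)

  length-codes : ∀ n → length (codes n) ≡ n !
  length-codes zero    = refl
  length-codes (suc n) = trans (length-cartesianProduct (allFin (suc n)) (codes n))
    (cong₂ _*_ (length-tabulate {n = suc n} id) (length-codes n))

  codes-unique : ∀ n → Unique (codes n)
  codes-unique zero    = [] AllPairs.∷ AllPairs.[]
  codes-unique (suc n) = Unique.cartesianProduct⁺ (Unique.allFin⁺ (suc n)) (codes-unique n)

  rank : ∀ {n} → Code n → Fin n → Fin n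
  rank {suc n} (j , c) zero    = j
  rank {suc n} (j , c) (suc x) = punchIn j (rank c x)

  rank-surjective : ∀ {n} (c : Code n) t → ∃ λ x → rank c x ≡ t
  rank-surjective {suc n} (j , c) t with j ≟ᶠ t
  ... | yes refl = zero , refl
  ... | no  j≢t  = let x , eq = rank-surjective c (punchOut j≢t) in
                   suc x , trans (cong (punchIn j) eq) (punchIn-punchOut j≢t)

  rank-injective : ∀ {n} {c c′ : Code n} → rank c ≗ rank c′ → c ≡ c′
  rank-injective {zero}                      _  = refl
  rank-injective {suc n} {j , c} {j′ , c′} eq with eq zero
  ... | refl = cong (j ,_) (rank-injective (λ x → punchIn-injective j _ _ (eq (suc x))))

  level : ∀ {n} → Code n → ℕ → Subset n
  level c i = tabulate (λ x → toℕ (rank c x) <ᵇ i)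

  chainOf : ∀ {n} → Code n → Chain n
  chainOf c = tabulate (level c ∘ toℕ)

  lookup-chainOf : ∀ {n} (c : Code n) i → lookup (chainOf c) i ≡ level c (toℕ i)
  lookup-chainOf c = lookup∘tabulate (level c ∘ toℕ)

  level-∈⁺ : ∀ {n} {c : Code n} {x i} → toℕ (rank c x) < i → x ∈ level c i
  level-∈⁺ {c = c} {x} {i} r<i =
    lookup⇒[]= x _ (trans (lookup∘tabulate _ x) (dec-true (toℕ (rank c x) <? i) r<i))

  level-∈⁻ : ∀ {n} {c : Code n} {x i} → x ∈ level c i → toℕ (rank c x) < i
  level-∈⁻ {c = c} {x} {i} x∈ =
    <ᵇ⇒< _ i (Equivalence.from T-≡ (trans (sym (lookup∘tabulate _ x)) ([]=⇒lookup x∈)))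

  level-⊂ : ∀ {n} (c : Code n) {i} → i < n → level c i ⊂ level c (suc i)
  level-⊂ c {i} i<n with rank-surjective c (fromℕ< i<n)
  ... | x , rank-x = level-∈⁺ ∘ m<n⇒m<1+n ∘ level-∈⁻ , x , level-∈⁺ (s≤s (≤-reflexive rank-x≡i)) , x∉
    where
    rank-x≡i : toℕ (rank c x) ≡ i
    rank-x≡i = trans (cong toℕ rank-x) (toℕ-fromℕ< i<n)
    x∉ : ¬ x ∈ level c i
    x∉ = <-irrefl refl ∘ subst (_< i) rank-x≡i ∘ level-∈⁻

  chainOf-isFullChain : ∀ {n} (c : Code n) → IsFullChain (chainOf c)
  chainOf-isFullChain {n} c = bottom , top , steps
    where
    bottom : level c 0 ≡ ⊥ₛ
    bottom = Empty-unique (λ (x , x∈) → n≮0 (level-∈⁻ {c = c} x∈))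
    top : lookup (chainOf c) (fromℕ n) ≡ ⊤ₛ
    top = trans (lookup-chainOf c (fromℕ n)) (trans (cong (level c) (toℕ-fromℕ n))
            (⊆-antisym ⊆⊤ (λ {x} _ → level-∈⁺ (toℕ<n (rank c x)))))
    steps : ∀ i → lookup (chainOf c) (inject₁ i) ⊂ lookup (chainOf c) (suc i)
    steps i = subst₂ _⊂_ (sym (trans (lookup-chainOf c (inject₁ i)) (cong (level c) (toℕ-inject₁ i))))
                         (sym (lookup-chainOf c (suc i))) (level-⊂ c (toℕ<n i))

  chainOf-rank-≤ : ∀ {n} {c c′ : Code n} → chainOf c ≡ chainOf c′ → ∀ x → toℕ (rank c x) ≤ toℕ (rank c′ x)
  chainOf-rank-≤ {n} {c} {c′} eq x = s≤s⁻¹ (level-∈⁻ (subst (x ∈_) same-level (level-∈⁺ ≤-refl)))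
    where
    i : Fin (suc n)
    i = suc (rank c′ x)
    same-level : level c′ (toℕ i) ≡ level c (toℕ i)
    same-level = trans (sym (lookup-chainOf c′ i)) (trans (cong (λ χ → lookup χ i) (sym eq)) (lookup-chainOf c i))

  chainOf-injective : ∀ {n} {c c′ : Code n} → chainOf c ≡ chainOf c′ → c ≡ c′
  chainOf-injective eq =
    rank-injective (λ x → toℕ-injective (≤-antisym (chainOf-rank-≤ eq x) (chainOf-rank-≤ (sym eq) x)))

  fullChain-unique : ∀ {n} (χ : Chain n) → IsFullChain χ → Unique (toList χ)
  fullChain-unique χ (_ , _ , steps) =
    AllPairs.map (λ p⊂q p≡q → ⊂-irref p≡q p⊂q) (Linked⇒AllPairs ⊂-trans (toList-linked χ steps))

  -- Counting chains through a set

  punchIn-<ᵇ-below : ∀ {n} (j : Fin (suc n)) (r : Fin n) {i} → toℕ j < i →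
                     (toℕ (punchIn j r) <ᵇ i) ≡ (toℕ r <ᵇ pred i)
  punchIn-<ᵇ-below zero    r       {suc i}       _         = refl
  punchIn-<ᵇ-below (suc j) zero    {suc (suc i)} _         = refl
  punchIn-<ᵇ-below (suc j) (suc r) {suc (suc i)} (s≤s j<i) = punchIn-<ᵇ-below j r j<i
  punchIn-<ᵇ-below (suc j) r       {suc zero}    (s≤s ())

  punchIn-<ᵇ-above : ∀ {n} (j : Fin (suc n)) (r : Fin n) {i} → i ≤ toℕ j →
                     (toℕ (punchIn j r) <ᵇ i) ≡ (toℕ r <ᵇ i)
  punchIn-<ᵇ-above j       r       {zero}  _         = refl
  punchIn-<ᵇ-above (suc j) zero    {suc i} _         = refl
  punchIn-<ᵇ-above (suc j) (suc r) {suc i} (s≤s i≤j) = punchIn-<ᵇ-above j r i≤j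

  level-below : ∀ {n} {j : Fin (suc n)} {c : Code n} {i} → toℕ j < i → level (j , c) i ≡ true ∷ level c (pred i)
  level-below {j = j} {c} {i} j<i =
    cong₂ _∷_ (dec-true (toℕ j <? i) j<i) (tabulate-cong (λ x → punchIn-<ᵇ-below j (rank c x) j<i))

  level-above : ∀ {n} {j : Fin (suc n)} {c : Code n} {i} → i ≤ toℕ j → level (j , c) i ≡ false ∷ level c i
  level-above {j = j} {c} {i} i≤j =
    cong₂ _∷_ (dec-false (toℕ j <? i) (≤⇒≯ i≤j)) (tabulate-cong (λ x → punchIn-<ᵇ-above j (rank c x) i≤j))

  sumOfSize : ∀ n → ℕ → (Subset n → ℕ) → ℕ
  sumOfSize n i w = ∑[ S ∈ subsets n ] (if does (∣ S ∣ ≟ i) then w S else 0)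

  ∑-subsets-suc : ∀ n (f : Subset (suc n) → ℕ) →
                  ∑ (subsets (suc n)) f ≡ ∑[ S ∈ subsets n ] f (true ∷ S) + ∑[ S ∈ subsets n ] f (false ∷ S)
  ∑-subsets-suc n f = trans (∑-++ f (map (true ∷_) (subsets n)) _)
    (cong₂ _+_ (∑-map (true ∷_) f (subsets n)) (∑-map (false ∷_) f (subsets n)))

  sumOfSize-zero : ∀ n (w : Subset (suc n) → ℕ) → sumOfSize (suc n) 0 w ≡ sumOfSize n 0 (w ∘ (false ∷_))
  sumOfSize-zero n w = trans (∑-subsets-suc n _) (cong (_+ sumOfSize n 0 (w ∘ (false ∷_))) (∑-zero (subsets n)))

  sumOfSize-suc : ∀ n i (w : Subset (suc n) → ℕ) →
                  sumOfSize (suc n) (suc i) w ≡ sumOfSize n i (w ∘ (true ∷_)) + sumOfSize n (suc i) (w ∘ (false ∷_))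
  sumOfSize-suc n i w = ∑-subsets-suc n _

  n<i⇒sumOfSize≡0 : ∀ n i (w : Subset n → ℕ) → n < i → sumOfSize n i w ≡ 0
  n<i⇒sumOfSize≡0 n i w n<i = trans (∑-cong too-large (subsets n)) (∑-zero (subsets n))
    where
    too-large : ∀ S → (if does (∣ S ∣ ≟ i) then w S else 0) ≡ 0
    too-large S = cong (if_then w S else 0) (dec-false (∣ S ∣ ≟ i) (λ { refl → <⇒≱ n<i (∣p∣≤n S) }))

  ∑-level-suc : ∀ {n} i k → i + k ≡ suc n → (w : Subset (suc n) → ℕ) →
                ∑[ c ∈ codes (suc n) ] w (level c i)
                  ≡ i * ∑[ c ∈ codes n ] w (true ∷ level c (pred i)) + k * ∑[ c ∈ codes n ] w (false ∷ level c i)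
  ∑-level-suc {n} i k i+k≡1+n w = begin
    ∑[ c ∈ codes (suc n) ] w (level c i)
      ≡⟨ ∑-cartesianProduct (λ c → w (level c i)) (allFin (suc n)) (codes n) ⟩
    ∑[ j ∈ allFin (suc n) ] ∑[ c ∈ codes n ] w (level (j , c) i)
      ≡⟨ ∑-cong by-position (allFin (suc n)) ⟩
    ∑[ j ∈ allFin (suc n) ] split j
      ≡⟨ cong (λ m → ∑[ j ∈ allFin m ] split j) i+k≡1+n ⟨
    ∑[ j ∈ allFin (i + k) ] split j
      ≡⟨ ∑-allFin-split i k X Y ⟩
    i * X + k * Y
      ∎
    where
    open ≡-Reasoning
    X Y : ℕ
    X = ∑[ c ∈ codes n ] w (true ∷ level c (pred i))
    Y = ∑[ c ∈ codes n ] w (false ∷ level c i)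
    split : ∀ {m} → Fin m → ℕ
    split j = if does (toℕ j <? i) then X else Y
    by-position : ∀ j → ∑[ c ∈ codes n ] w (level (j , c) i) ≡ split j
    by-position j = ≡-if-does (toℕ j <? i)
      (λ j<i → ∑-cong (λ c → cong w (level-below j<i)) (codes n))
      (λ j≮i → ∑-cong (λ c → cong w (level-above (≮⇒≥ j≮i))) (codes n))

  -- In the inductive step the i+1 ranks of element 0 that put it into level i+1 and the k+1
  -- ranks that keep it out contribute the same multiplicity, as
  -- (i+1) · i! (k+1)! = (k+1) · (i+1)! k! = (i+1)! (k+1)!.
  ∑-level : ∀ {n} i k → i + k ≡ n → (w : Subset n → ℕ) →
            ∑[ c ∈ codes n ] w (level c i) ≡ i ! * k ! * sumOfSize n i w
  ∑-level {zero}  zero    zero    refl w = sym (+-identityʳ _)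
  ∑-level {suc n} zero    (suc k) e    w = begin
    ∑[ c ∈ codes (suc n) ] w (level c 0)
      ≡⟨ ∑-level-suc 0 (suc k) e w ⟩
    suc k * ∑[ c ∈ codes n ] w (false ∷ level c 0)
      ≡⟨ cong (suc k *_) (∑-level 0 k (suc-injective e) (w ∘ (false ∷_))) ⟩
    suc k * (1 * k ! * out₀)
      ≡⟨ arith k (k !) out₀ ⟩
    1 * (suc k) ! * out₀
      ≡⟨ cong (1 * (suc k) ! *_) (sumOfSize-zero n w) ⟨
    1 * (suc k) ! * sumOfSize (suc n) 0 w
      ∎
    where
    open ≡-Reasoning
    out₀ : ℕ
    out₀ = sumOfSize n 0 (w ∘ (false ∷_))
    arith : ∀ k f a → suc k * (1 * f * a) ≡ 1 * (suc k * f) * a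
    arith = solve-∀
  ∑-level {suc n} (suc i) zero    e    w = begin
    ∑[ c ∈ codes (suc n) ] w (level c (suc i))
      ≡⟨ ∑-level-suc (suc i) 0 e w ⟩
    suc i * ∑[ c ∈ codes n ] w (true ∷ level c i) + 0
      ≡⟨ cong (λ x → suc i * x + 0) (∑-level i 0 (suc-injective e) (w ∘ (true ∷_))) ⟩
    suc i * (i ! * 1 * in₀) + 0
      ≡⟨ arith i (i !) in₀ ⟩
    (suc i) ! * 1 * (in₀ + 0)
      ≡⟨ cong (λ x → (suc i) ! * 1 * (in₀ + x)) out₀≡0 ⟨
    (suc i) ! * 1 * (in₀ + out₀)
      ≡⟨ cong ((suc i) ! * 1 *_) (sumOfSize-suc n i w) ⟨
    (suc i) ! * 1 * sumOfSize (suc n) (suc i) w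
      ∎
    where
    open ≡-Reasoning
    in₀ out₀ : ℕ
    in₀ = sumOfSize n i (w ∘ (true ∷_))
    out₀ = sumOfSize n (suc i) (w ∘ (false ∷_))
    arith : ∀ i f a → suc i * (f * 1 * a) + 0 ≡ (suc i * f) * 1 * (a + 0)
    arith = solve-∀
    out₀≡0 : out₀ ≡ 0
    out₀≡0 = n<i⇒sumOfSize≡0 n (suc i) _ (s≤s (≤-reflexive (trans (sym (suc-injective e)) (+-identityʳ i))))
  ∑-level {suc n} (suc i) (suc k) e    w = begin
    ∑[ c ∈ codes (suc n) ] w (level c (suc i))
      ≡⟨ ∑-level-suc (suc i) (suc k) e w ⟩
    suc i * ∑[ c ∈ codes n ] w (true ∷ level c i) + suc k * ∑[ c ∈ codes n ] w (false ∷ level c (suc i))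
      ≡⟨ cong₂ (λ x y → suc i * x + suc k * y)
               (∑-level i (suc k) (suc-injective e) (w ∘ (true ∷_)))
               (∑-level (suc i) k (trans (sym (+-suc i k)) (suc-injective e)) (w ∘ (false ∷_))) ⟩
    suc i * (i ! * (suc k) ! * in₀) + suc k * ((suc i) ! * k ! * out₀)
      ≡⟨ arith i k (i !) (k !) in₀ out₀ ⟩
    (suc i) ! * (suc k) ! * (in₀ + out₀)
      ≡⟨ cong ((suc i) ! * (suc k) ! *_) (sumOfSize-suc n i w) ⟨
    (suc i) ! * (suc k) ! * sumOfSize (suc n) (suc i) w
      ∎
    where
    open ≡-Reasoning
    in₀ out₀ : ℕ
    in₀ = sumOfSize n i (w ∘ (true ∷_))
    out₀ = sumOfSize n (suc i) (w ∘ (false ∷_))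
    arith : ∀ i k f g a b → suc i * (f * (suc k * g) * a) + suc k * ((suc i * f) * g * b)
                          ≡ (suc i * f) * (suc k * g) * (a + b)
    arith = solve-∀

  chainsThrough : ∀ {n} → Subset n → ℕ
  chainsThrough {n} S = ∣ S ∣ ! * (n ∸ ∣ S ∣) !

  sumOfSize-chainsThrough : ∀ n i (w : Subset n → ℕ) →
                            i ! * (n ∸ i) ! * sumOfSize n i w ≡ sumOfSize n i (λ S → chainsThrough S * w S)
  sumOfSize-chainsThrough n i w = trans (∑-*ˡ (i ! * (n ∸ i) !) _ (subsets n)) (∑-cong term (subsets n))
    where
    term : ∀ S → i ! * (n ∸ i) ! * (if does (∣ S ∣ ≟ i) then w S else 0)
               ≡ (if does (∣ S ∣ ≟ i) then chainsThrough S * w S else 0)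
    term S = by-cases (∣ S ∣ ≟ i)
      where
      by-cases : (d : Dec (∣ S ∣ ≡ i)) → i ! * (n ∸ i) ! * (if does d then w S else 0)
                                          ≡ (if does d then chainsThrough S * w S else 0)
      by-cases (yes |S|≡i) = cong (λ m → m ! * (n ∸ m) ! * w S) (sym |S|≡i)
      by-cases (no  _)     = *-zeroʳ (i ! * (n ∸ i) !)

  ∑-sumOfSize : ∀ n (w : Subset n → ℕ) → ∑[ i ∈ allFin (suc n) ] sumOfSize n (toℕ i) w ≡ ∑ (subsets n) w
  ∑-sumOfSize n w = trans (∑-comm (λ i S → if does (∣ S ∣ ≟ toℕ i) then w S else 0) (allFin (suc n)) (subsets n))
                          (∑-cong (λ S → ∑-allFin-≟ n ∣ S ∣ (w S) (∣p∣≤n S)) (subsets n))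

  ∑-levels : ∀ n (w : Subset n → ℕ) →
             ∑[ c ∈ codes n ] ∑[ i ∈ allFin (suc n) ] w (level c (toℕ i)) ≡ ∑[ S ∈ subsets n ] (chainsThrough S * w S)
  ∑-levels n w = begin
    ∑[ c ∈ codes n ] ∑[ i ∈ allFin (suc n) ] w (level c (toℕ i))
      ≡⟨ ∑-comm (λ c i → w (level c (toℕ i))) (codes n) (allFin (suc n)) ⟩
    ∑[ i ∈ allFin (suc n) ] ∑[ c ∈ codes n ] w (level c (toℕ i))
      ≡⟨ ∑-cong at-level (allFin (suc n)) ⟩
    ∑[ i ∈ allFin (suc n) ] sumOfSize n (toℕ i) (λ S → chainsThrough S * w S)
      ≡⟨ ∑-sumOfSize n _ ⟩
    ∑[ S ∈ subsets n ] (chainsThrough S * w S)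
      ∎
    where
    open ≡-Reasoning
    at-level : ∀ i → ∑[ c ∈ codes n ] w (level c (toℕ i)) ≡ sumOfSize n (toℕ i) (λ S → chainsThrough S * w S)
    at-level i = trans (∑-level (toℕ i) (n ∸ toℕ i) (m+[n∸m]≡n (toℕ≤pred[n] i)) w)
                       (sumOfSize-chainsThrough n (toℕ i) w)

  -- The marked chain family

  chainMembers : ∀ {n} → Family n → Chain n → List (Subset n)
  chainMembers 𝓕 χ = filterᵇ 𝓕 (toList χ)

  length-chainMembers : ∀ {n} (𝓕 : Family n) χ → length (chainMembers 𝓕 χ) ≡ chainMeet 𝓕 χ
  length-chainMembers 𝓕 χ = length-filterᵇ 𝓕 (toList χ)

  chainMembers-unique : ∀ {n} (𝓕 : Family n) χ → IsFullChain χ → Unique (chainMembers 𝓕 χ)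
  chainMembers-unique 𝓕 χ fc = Unique.filter⁺ (T? ∘ 𝓕) (fullChain-unique χ fc)

  chainMembers-sound : ∀ {n} (𝓕 : Family n) χ → All (λ G → G VM.∈ χ × 𝓕 G ≡ true) (chainMembers 𝓕 χ)
  chainMembers-sound 𝓕 χ = All.tabulate λ G∈ →
    let G∈χ , 𝓕G = ∈-filter⁻ (T? ∘ 𝓕) G∈ in ∈-toList⁻ G∈χ , Equivalence.to T-≡ 𝓕G

  chainMembers-𝓣 : ∀ {n} q (𝓕 : Family n) {χ} → IsFullChain χ → q ≤ chainMeet 𝓕 χ →
                   All (λ G → 𝓣[ q , 𝓕 ] (χ , G)) (chainMembers 𝓕 χ)
  chainMembers-𝓣 q 𝓕 {χ} fc q≤ = All.map (λ (G∈χ , 𝓕G) → fc , G∈χ , 𝓕G , q≤) (chainMembers-sound 𝓕 χ)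

  markedPairsOn : ∀ {n} → ℕ → Family n → Chain n → List (MarkedPair n)
  markedPairsOn q 𝓕 χ with q ≤? chainMeet 𝓕 χ
  ... | yes _ = map (χ ,_) (chainMembers 𝓕 χ)
  ... | no  _ = []

  markedPairsOn-𝓣 : ∀ {n} q (𝓕 : Family n) {χ} → IsFullChain χ → All 𝓣[ q , 𝓕 ] (markedPairsOn q 𝓕 χ)
  markedPairsOn-𝓣 q 𝓕 {χ} fc with q ≤? chainMeet 𝓕 χ
  ... | yes q≤ = All.map⁺ (chainMembers-𝓣 q 𝓕 fc q≤)
  ... | no  _  = []

  markedPairsOn-unique : ∀ {n} q (𝓕 : Family n) {χ} → IsFullChain χ → Unique (markedPairsOn q 𝓕 χ)
  markedPairsOn-unique q 𝓕 {χ} fc with q ≤? chainMeet 𝓕 χ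
  ... | yes _ = Unique.map⁺ (cong proj₂) (chainMembers-unique 𝓕 χ fc)
  ... | no  _ = AllPairs.[]

  markedPairsOn-chain : ∀ {n} q (𝓕 : Family n) χ → All (λ x → proj₁ x ≡ χ) (markedPairsOn q 𝓕 χ)
  markedPairsOn-chain q 𝓕 χ with q ≤? chainMeet 𝓕 χ
  ... | yes _ = All.map⁺ (All.universal (λ _ → refl) (chainMembers 𝓕 χ))
  ... | no  _ = []

  chainMeet-≤-markedPairsOn : ∀ {n} q (𝓕 : Family n) χ → chainMeet 𝓕 χ ≤ length (markedPairsOn q 𝓕 χ) + pred q
  chainMeet-≤-markedPairsOn q 𝓕 χ with q ≤? chainMeet 𝓕 χ
  ... | yes _  = ≤-trans (≤-reflexive (sym (trans (length-map (χ ,_) (chainMembers 𝓕 χ)) (length-chainMembers 𝓕 χ))))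
                         (m≤m+n _ (pred q))
  ... | no  q≰ = <⇒≤pred (≰⇒> q≰)

  markedPairs : ∀ {n} → ℕ → Family n → List (MarkedPair n)
  markedPairs {n} q 𝓕 = concatMap (markedPairsOn q 𝓕 ∘ chainOf) (codes n)

  markedPairs-𝓣 : ∀ {n} q (𝓕 : Family n) → All 𝓣[ q , 𝓕 ] (markedPairs q 𝓕)
  markedPairs-𝓣 {n} q 𝓕 = All.concat⁺ (All.map⁺ (All.universal (markedPairsOn-𝓣 q 𝓕 ∘ chainOf-isFullChain) (codes n)))

  markedPairs-unique : ∀ {n} q (𝓕 : Family n) → Unique (markedPairs q 𝓕)
  markedPairs-unique {n} q 𝓕 = Unique.concat⁺
    (All.map⁺ (All.universal (markedPairsOn-unique q 𝓕 ∘ chainOf-isFullChain) (codes n)))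
    (AllPairs.map⁺ (AllPairs.map disjoint (codes-unique n)))
    where
    on : ∀ {c} {x} → x ∈ₗ markedPairsOn q 𝓕 (chainOf c) → proj₁ x ≡ chainOf c
    on {c} = All.lookup (markedPairsOn-chain q 𝓕 (chainOf c))
    disjoint : ∀ {c c′} → c ≢ c′ → Disjoint (markedPairsOn q 𝓕 (chainOf c)) (markedPairsOn q 𝓕 (chainOf c′))
    disjoint c≢c′ (x∈ , x∈′) = c≢c′ (chainOf-injective (trans (sym (on x∈)) (on x∈′)))

  ∑-chainMeet : ∀ {n} (𝓕 : Family n) → ∑[ c ∈ codes n ] chainMeet 𝓕 (chainOf c) ≡ ∑ (members 𝓕) chainsThrough
  ∑-chainMeet {n} 𝓕 = begin
    ∑[ c ∈ codes n ] chainMeet 𝓕 (chainOf c)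
      ≡⟨ ∑-cong (λ c → foldr-+-tabulate {m = suc n} 𝟙𝓕 (level c ∘ toℕ)) (codes n) ⟩
    ∑[ c ∈ codes n ] ∑[ i ∈ allFin (suc n) ] 𝟙𝓕 (level c (toℕ i))
      ≡⟨ ∑-levels n 𝟙𝓕 ⟩
    ∑[ S ∈ subsets n ] (chainsThrough S * 𝟙𝓕 S)
      ≡⟨ ∑-cong restrict (subsets n) ⟩
    ∑[ S ∈ subsets n ] (if 𝓕 S then chainsThrough S else 0)
      ≡⟨ ∑-keep 𝓕 chainsThrough (subsets n) ⟨
    ∑ (members 𝓕) chainsThrough
      ∎
    where
    open ≡-Reasoning
    𝟙𝓕 : Subset n → ℕ
    𝟙𝓕 S = if 𝓕 S then 1 else 0
    restrict : ∀ S → chainsThrough S * 𝟙𝓕 S ≡ (if 𝓕 S then chainsThrough S else 0)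
    restrict S with 𝓕 S
    ... | true  = *-identityʳ (chainsThrough S)
    ... | false = *-zeroʳ (chainsThrough S)

  ∑-members-chainsThrough-≤ : ∀ {n} q (𝓕 : Family n) →
                              ∑ (members 𝓕) chainsThrough ≤ length (markedPairs q 𝓕) + n ! * pred q
  ∑-members-chainsThrough-≤ {n} q 𝓕 = begin
    ∑ (members 𝓕) chainsThrough
      ≡⟨ ∑-chainMeet 𝓕 ⟨
    ∑[ c ∈ codes n ] chainMeet 𝓕 (chainOf c)
      ≤⟨ ∑-mono-≤ (chainMeet-≤-markedPairsOn q 𝓕 ∘ chainOf) (codes n) ⟩
    ∑[ c ∈ codes n ] (length (markedPairsOn q 𝓕 (chainOf c)) + pred q)
      ≡⟨ ∑-+ (length ∘ markedPairsOn q 𝓕 ∘ chainOf) _ (codes n) ⟩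
    ∑[ c ∈ codes n ] length (markedPairsOn q 𝓕 (chainOf c)) + ∑ (codes n) (λ _ → pred q)
      ≡⟨ cong₂ _+_ (sym (length-concatMap (markedPairsOn q 𝓕 ∘ chainOf) (codes n)))
                   (trans (∑-const (codes n) (pred q)) (cong (_* pred q) (length-codes n))) ⟩
    length (markedPairs q 𝓕) + n ! * pred q
      ∎
    where open ≤-Reasoning

  𝓣-strong : ∀ {n} q (𝓕 : Family n) → IsStrong q 𝓣[ q , 𝓕 ]
  𝓣-strong q 𝓕 χ F (fc , _ , _ , q≤|χ∩𝓕|) =
    chainMembers 𝓕 χ , chainMembers-unique 𝓕 χ fc , chainMembers-𝓣 q 𝓕 fc q≤|χ∩𝓕| ,
    ≤-trans q≤|χ∩𝓕| (≤-reflexive (sym (length-chainMembers 𝓕 χ)))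


module LubellWeight where

  open ChainCounting using (∑; chainsThrough; markedPairs; ∑-members-chainsThrough-≤)
  open import Data.Nat as ℕ using (ℕ; suc; _!; pred; _⊔_; NonZero; >-nonZero)
  import Data.Nat.Properties as ℕ
  open import Data.Nat.Combinatorics using (_C_; nCk≡n!/k![n-k]!; k![n∸k]!∣n!)
  open import Data.Nat.DivMod using (m/n*n≡m)
  open import Data.Integer as ℤ using (+_)
  import Data.Integer.Properties as ℤ
  open import Data.Integer.Tactic.RingSolver using (solve-∀)
  open import Data.Rational using (ℚ; 0ℚ; 1ℚ; _/_; _+_; _-_; _*_; -_; _≤_; fromℚᵘ; toℚᵘ; NonNegative; Positive)
  open import Data.Rational.Properties
  open import Data.Rational.Unnormalised as ℚᵘ using (mkℚᵘ; *≡*)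
  import Data.Rational.Unnormalised.Properties as ℚᵘ
  open import Data.Fin.Subset using (Subset; ∣_∣)
  open import Data.Fin.Subset.Properties using (∣p∣≤n)
  open import Data.List using (List; []; _∷_; foldr; length)
  open import Data.List.Relation.Unary.All as All using (All; []; _∷_)
  open import Relation.Binary.PropositionalEquality

  fromℕ : ℕ → ℚ
  fromℕ n = + n / 1

  fromℕ-nonNeg : ∀ n → NonNegative (fromℕ n)
  fromℕ-nonNeg n = normalize-nonNeg n 1

  fromℕ-pos : ∀ n → 0 ℕ.< n → Positive (fromℕ n)
  fromℕ-pos (suc n) _ = normalize-pos (suc n) 1

  -- + n / 1 is normalised by a gcd computation that does not reduce for variable n,
  -- so the arithmetic of fromℕ is transported from ℚᵘ.
  fromℚᵘ-homo-+ : ∀ p q → fromℚᵘ (p ℚᵘ.+ q) ≡ fromℚᵘ p + fromℚᵘ q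
  fromℚᵘ-homo-+ p q = toℚᵘ-injective (begin-equality
    toℚᵘ (fromℚᵘ (p ℚᵘ.+ q))                  ≃⟨ toℚᵘ-fromℚᵘ (p ℚᵘ.+ q) ⟩
    p ℚᵘ.+ q                                  ≃⟨ ℚᵘ.+-cong (toℚᵘ-fromℚᵘ p) (toℚᵘ-fromℚᵘ q) ⟨
    toℚᵘ (fromℚᵘ p) ℚᵘ.+ toℚᵘ (fromℚᵘ q)      ≃⟨ toℚᵘ-homo-+ (fromℚᵘ p) (fromℚᵘ q) ⟨
    toℚᵘ (fromℚᵘ p + fromℚᵘ q)                ∎)
    where open ℚᵘ.≤-Reasoning

  fromℚᵘ-homo-* : ∀ p q → fromℚᵘ (p ℚᵘ.* q) ≡ fromℚᵘ p * fromℚᵘ q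
  fromℚᵘ-homo-* p q = toℚᵘ-injective (begin-equality
    toℚᵘ (fromℚᵘ (p ℚᵘ.* q))                  ≃⟨ toℚᵘ-fromℚᵘ (p ℚᵘ.* q) ⟩
    p ℚᵘ.* q                                  ≃⟨ ℚᵘ.*-cong (toℚᵘ-fromℚᵘ p) (toℚᵘ-fromℚᵘ q) ⟨
    toℚᵘ (fromℚᵘ p) ℚᵘ.* toℚᵘ (fromℚᵘ q)      ≃⟨ toℚᵘ-homo-* (fromℚᵘ p) (fromℚᵘ q) ⟨
    toℚᵘ (fromℚᵘ p * fromℚᵘ q)                ∎)
    where open ℚᵘ.≤-Reasoning

  fromℕ-homo-+ : ∀ a b → fromℕ (a ℕ.+ b) ≡ fromℕ a + fromℕ b
  fromℕ-homo-+ a b = trans (fromℚᵘ-cong cross)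
                           (fromℚᵘ-homo-+ (mkℚᵘ (+ a) 0) (mkℚᵘ (+ b) 0))
    where
    ring : ∀ x y → (x ℤ.+ y) ℤ.* + 1 ≡ (x ℤ.* + 1 ℤ.+ y ℤ.* + 1) ℤ.* + 1
    ring = solve-∀
    cross : mkℚᵘ (+ (a ℕ.+ b)) 0 ℚᵘ.≃ mkℚᵘ (+ a) 0 ℚᵘ.+ mkℚᵘ (+ b) 0
    cross = *≡* (trans (cong (ℤ._* + 1) (ℤ.pos-+ a b)) (ring (+ a) (+ b)))

  fromℕ-homo-* : ∀ a b → fromℕ (a ℕ.* b) ≡ fromℕ a * fromℕ b
  fromℕ-homo-* a b = trans (fromℚᵘ-cong cross)
                           (fromℚᵘ-homo-* (mkℚᵘ (+ a) 0) (mkℚᵘ (+ b) 0))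
    where
    cross : mkℚᵘ (+ (a ℕ.* b)) 0 ℚᵘ.≃ mkℚᵘ (+ a) 0 ℚᵘ.* mkℚᵘ (+ b) 0
    cross = *≡* (cong (ℤ._* + 1) (ℤ.pos-* a b))

  1/n*n≡1 : ∀ n .{{_ : NonZero n}} → (+ 1 / n) * fromℕ n ≡ 1ℚ
  1/n*n≡1 (suc m) = trans (sym (fromℚᵘ-homo-* (mkℚᵘ (+ 1) m) (mkℚᵘ (+ suc m) 0)))
                          (fromℚᵘ-cong cross)
    where
    ring : ∀ x → (+ 1 ℤ.* x) ℤ.* + 1 ≡ + 1 ℤ.* (x ℤ.* + 1)
    ring = solve-∀
    cross : mkℚᵘ (+ 1) m ℚᵘ.* mkℚᵘ (+ suc m) 0 ℚᵘ.≃ ℚᵘ.1ℚᵘ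
    cross = *≡* (trans (ring (+ suc m)) (cong (+ 1 ℤ.*_) (sym (ℤ.pos-* (suc m) 1))))

  fromℕ-mono-≤ : ∀ {a b} → a ℕ.≤ b → fromℕ a ≤ fromℕ b
  fromℕ-mono-≤ {a} {b} a≤b = begin
    fromℕ a                    ≡⟨ +-identityʳ (fromℕ a) ⟨
    fromℕ a + 0ℚ               ≤⟨ +-monoʳ-≤ (fromℕ a) (nonNegative⁻¹ (fromℕ (b ℕ.∸ a)) {{fromℕ-nonNeg (b ℕ.∸ a)}}) ⟩
    fromℕ a + fromℕ (b ℕ.∸ a)  ≡⟨ fromℕ-homo-+ a (b ℕ.∸ a) ⟨
    fromℕ (a ℕ.+ (b ℕ.∸ a))    ≡⟨ cong fromℕ (ℕ.m+[n∸m]≡n a≤b) ⟩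
    fromℕ b                    ∎
    where open ≤-Reasoning

  p+q-q≡p : ∀ p q → p + q - q ≡ p
  p+q-q≡p p q = trans (+-assoc p q (- q)) (trans (cong (_+_ p) (+-inverseʳ q)) (+-identityʳ p))

  +-cancelʳ-≤ : ∀ p q r → p + r ≤ q + r → p ≤ q
  +-cancelʳ-≤ p q r p+r≤q+r = subst₂ _≤_ (p+q-q≡p p r) (p+q-q≡p q r) (+-monoˡ-≤ (- r) p+r≤q+r)

  fromℕ-pred : ∀ q .{{_ : NonZero q}} → fromℕ q - 1ℚ ≡ fromℕ (pred q)
  fromℕ-pred q = trans (cong (λ m → fromℕ m - 1ℚ) (trans (sym (ℕ.suc-pred q)) (ℕ.+-comm 1 (pred q))))
    (trans (cong (_- 1ℚ) (fromℕ-homo-+ (pred q) 1)) (p+q-q≡p (fromℕ (pred q)) 1ℚ))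

  nCk*k!*[n∸k]!≡n! : ∀ {n k} → k ℕ.≤ n → (n C k) ℕ.* (k ! ℕ.* (n ℕ.∸ k) !) ≡ n !
  nCk*k!*[n∸k]!≡n! {n} {k} k≤n =
    trans (cong (ℕ._* (k ! ℕ.* (n ℕ.∸ k) !)) (nCk≡n!/k![n-k]! k≤n)) (m/n*n≡m (k![n∸k]!∣n! k≤n))
    where
    instance
      k!*[n∸k]!≢0 : NonZero (k ! ℕ.* (n ℕ.∸ k) !)
      k!*[n∸k]!≢0 = k ℕ.!* (n ℕ.∸ k) !≢0

  binom-nonZero : ∀ n (S : Subset n) → NonZero (n C ∣ S ∣)
  binom-nonZero n S = >-nonZero (nCk>0 n ∣ S ∣ (∣p∣≤n S))

  invBinom-*-binom : ∀ n (S : Subset n) → invBinom n S * fromℕ (n C ∣ S ∣) ≡ 1ℚ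
  invBinom-*-binom n S = 1/n*n≡1 (n C ∣ S ∣) {{binom-nonZero n S}}

  invBinom-*-! : ∀ n (S : Subset n) → invBinom n S * fromℕ (n !) ≡ fromℕ (chainsThrough S)
  invBinom-*-! n S = begin
    invBinom n S * fromℕ (n !)
      ≡⟨ cong (λ m → invBinom n S * fromℕ m) (nCk*k!*[n∸k]!≡n! (∣p∣≤n S)) ⟨
    invBinom n S * fromℕ ((n C ∣ S ∣) ℕ.* chainsThrough S)
      ≡⟨ cong (invBinom n S *_) (fromℕ-homo-* (n C ∣ S ∣) (chainsThrough S)) ⟩
    invBinom n S * (fromℕ (n C ∣ S ∣) * fromℕ (chainsThrough S))
      ≡⟨ *-assoc (invBinom n S) _ _ ⟨
    invBinom n S * fromℕ (n C ∣ S ∣) * fromℕ (chainsThrough S)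
      ≡⟨ cong (_* fromℕ (chainsThrough S)) (invBinom-*-binom n S) ⟩
    1ℚ * fromℕ (chainsThrough S)
      ≡⟨ *-identityˡ (fromℕ (chainsThrough S)) ⟩
    fromℕ (chainsThrough S)
      ∎
    where open ≡-Reasoning

  μ : ∀ {n} → List (Subset n) → ℚ
  μ {n} = foldr (λ S acc → invBinom n S + acc) 0ℚ

  μ-*-n! : ∀ {n} (xs : List (Subset n)) → μ xs * fromℕ (n !) ≡ fromℕ (∑ xs chainsThrough)
  μ-*-n! {n} []       = *-zeroˡ (fromℕ (n !))
  μ-*-n! {n} (S ∷ xs) = trans (*-distribʳ-+ (fromℕ (n !)) (invBinom n S) (μ xs))
    (trans (cong₂ _+_ (invBinom-*-! n S) (μ-*-n! xs)) (sym (fromℕ-homo-+ (chainsThrough S) (∑ xs chainsThrough))))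

  invBinom-nonNeg : ∀ n (S : Subset n) → NonNegative (invBinom n S)
  invBinom-nonNeg n S = normalize-nonNeg 1 (n C ∣ S ∣) {{binom-nonZero n S}}

  All-≤-foldr-⊔ : ∀ {A : Set} (f : A → ℕ) xs → All (λ x → f x ℕ.≤ foldr (λ y acc → f y ⊔ acc) 0 xs) xs
  All-≤-foldr-⊔ f []       = []
  All-≤-foldr-⊔ f (x ∷ xs) =
    ℕ.m≤m⊔n (f x) _ ∷ All.map (λ le → ℕ.≤-trans le (ℕ.m≤n⊔m (f x) _)) (All-≤-foldr-⊔ f xs)

  foldr-⊔-pos : ∀ {A : Set} (f : A → ℕ) xs → 0 ℕ.< length xs → (∀ x → 0 ℕ.< f x) →
                0 ℕ.< foldr (λ y acc → f y ⊔ acc) 0 xs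
  foldr-⊔-pos f (x ∷ xs) _ f-pos = ℕ.≤-trans (f-pos x) (ℕ.m≤m⊔n (f x) _)

  length≤μ*M : ∀ {n} M (xs : List (Subset n)) → All (λ S → n C ∣ S ∣ ℕ.≤ M) xs →
                         fromℕ (length xs) ≤ μ xs * fromℕ M
  length≤μ*M M []       []             = ≤-reflexive (sym (*-zeroˡ (fromℕ M)))
  length≤μ*M {n} M (S ∷ xs) (C≤M ∷ C≤M*) = begin
    fromℕ (suc (length xs))                     ≡⟨ fromℕ-homo-+ 1 (length xs) ⟩
    1ℚ + fromℕ (length xs)                      ≤⟨ +-mono-≤ 1≤ (length≤μ*M M xs C≤M*) ⟩
    invBinom n S * fromℕ M + μ xs * fromℕ M     ≡⟨ *-distribʳ-+ (fromℕ M) (invBinom n S) (μ xs) ⟨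
    μ (S ∷ xs) * fromℕ M                        ∎
    where
    open ≤-Reasoning
    1≤ : 1ℚ ≤ invBinom n S * fromℕ M
    1≤ = begin
      1ℚ                                ≡⟨ invBinom-*-binom n S ⟨
      invBinom n S * fromℕ (n C ∣ S ∣)  ≤⟨ *-monoˡ-≤-nonNeg (invBinom n S) {{invBinom-nonNeg n S}} (fromℕ-mono-≤ C≤M) ⟩
      invBinom n S * fromℕ M            ∎

  r*maxBinom≤card⇒r≤lubell : ∀ {n} (𝓕 : Family n) r → 0 ℕ.< card 𝓕 →
                             r * fromℕ (maxBinom 𝓕) ≤ fromℕ (card 𝓕) → r ≤ lubell 𝓕
  r*maxBinom≤card⇒r≤lubell {n} 𝓕 r card>0 r*M≤card =
    *-cancelʳ-≤-pos (fromℕ (maxBinom 𝓕)) {{fromℕ-pos (maxBinom 𝓕) M>0}}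
      (≤-trans r*M≤card (length≤μ*M (maxBinom 𝓕) (members 𝓕) (All-≤-foldr-⊔ (λ S → n C ∣ S ∣) (members 𝓕))))
    where
    M>0 : 0 ℕ.< maxBinom 𝓕
    M>0 = foldr-⊔-pos (λ S → n C ∣ S ∣) (members 𝓕) card>0 (λ S → nCk>0 n ∣ S ∣ (∣p∣≤n S))

  markedPairs-large : ∀ {n} q .{{_ : NonZero q}} (ε : ℚ) (𝓕 : Family n) → fromℕ q - 1ℚ + ε ≤ lubell 𝓕 →
                      ε * fromℕ (n !) ≤ fromℕ (length (markedPairs q 𝓕))
  markedPairs-large {n} q ε 𝓕 q-1+ε≤μ = +-cancelʳ-≤ (ε * N) T (a * N) (begin
    ε * N + a * N
      ≡⟨ trans (*-distribʳ-+ N a ε) (+-comm (a * N) (ε * N)) ⟨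
    (a + ε) * N
      ≤⟨ *-monoʳ-≤-nonNeg N {{fromℕ-nonNeg (n !)}} (subst (λ x → x + ε ≤ lubell 𝓕) (fromℕ-pred q) q-1+ε≤μ) ⟩
    lubell 𝓕 * N
      ≡⟨ μ-*-n! (members 𝓕) ⟩
    fromℕ (∑ (members 𝓕) chainsThrough)
      ≤⟨ fromℕ-mono-≤ (∑-members-chainsThrough-≤ q 𝓕) ⟩
    fromℕ (length (markedPairs q 𝓕) ℕ.+ n ! ℕ.* pred q)
      ≡⟨ fromℕ-homo-+ (length (markedPairs q 𝓕)) _ ⟩
    T + fromℕ (n ! ℕ.* pred q)
      ≡⟨ cong (_+_ T) (trans (fromℕ-homo-* (n !) (pred q)) (*-comm N a)) ⟩
    T + a * N
      ∎)
    where
    open ≤-Reasoning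
    N a T : ℚ
    N = fromℕ (n !)
    a = fromℕ (pred q)
    T = fromℕ (length (markedPairs q 𝓕))

open ChainCounting using (markedPairs; markedPairs-unique; markedPairs-𝓣; 𝓣-strong)
open LubellWeight using (fromℕ; r*maxBinom≤card⇒r≤lubell; markedPairs-large)
open import Data.Nat using (ℕ; _≤_; _!; NonZero; >-nonZero) renaming (_<_ to _<ℕ_)
open import Data.Integer using (+_)
open import Data.Rational using (ℚ; 0ℚ; 1ℚ; _/_; _+_; _-_; _*_; _<_) renaming (_≤_ to _≤ℚ_)
open import Data.Product using (_×_; _,_)

lemma4p2 : (n q : ℕ) → 1 ≤ q → (ε : ℚ) → 0ℚ < ε → (𝓕 : Family n) →
  (((+ q / 1) - 1ℚ + ε) ≤ℚ lubell 𝓕 →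
     IsMarkedFamily 𝓕 𝓣[ q , 𝓕 ] × IsStrong q 𝓣[ q , 𝓕 ]
       × AtLeastℚ (ε * (+ (n !) / 1)) 𝓣[ q , 𝓕 ])
  × (0 <ℕ card 𝓕 → ((+ q / 1) - 1ℚ + ε) * (+ maxBinom 𝓕 / 1) ≤ℚ (+ card 𝓕 / 1) →
     AtLeastℚ (ε * (+ (n !) / 1)) 𝓣[ q , 𝓕 ])
lemma4p2 n q q≥1 ε _ 𝓕 =
  (λ q-1+ε≤μ → (λ χ F (fc , F∈χ , F∈𝓕 , _) → fc , F∈χ , F∈𝓕) , 𝓣-strong q 𝓕 , large q-1+ε≤μ) ,
  (λ card>0 q-1+ε≤card/M → large (r*maxBinom≤card⇒r≤lubell 𝓕 _ card>0 q-1+ε≤card/M))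
  where
  instance
    q≢0 : NonZero q
    q≢0 = >-nonZero q≥1
  large : fromℕ q - 1ℚ + ε ≤ℚ lubell 𝓕 → AtLeastℚ (ε * fromℕ (n !)) 𝓣[ q , 𝓕 ]
  large q-1+ε≤μ = markedPairs q 𝓕 , markedPairs-unique q 𝓕 , markedPairs-𝓣 q 𝓕 , markedPairs-large q ε 𝓕 q-1+ε≤μ
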